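{- Define integer polynomials $G_i(x)$ by $G_0(x)=1$, $G_1(x)=x$, and $G_i(x)=xG_{i-1}(x)-G_{i-2}(x)$ for $i\geq 2$. For an integer $n>1$ let $\mathcal{A}(n)=\{a\in\mathbb{Z} : 1\leq a<n,\ n \mid a^2-1,\ a\mid n^2-1\}$. Then for all integers $i\geq 1$ and $k\geq 2$, we have $G_{i-1}(k)\in\mathcal{A}(G_i(k))$.
   Context: $G_i$ are the polynomials defined by the stated recurrence (a Fibonacci-like recurrence with a minus sign). $\mathcal{A}(n)$ is as defined in the claim. -}

module Defs where

open import Data.Nat using (ℕ; zero; suc)
open import Data.Integer using (ℤ; _+_; _*_; _-_; _≤_; _<_; _>_; +_; 1ℤ)
open import Data.Integer.Divisibility using (_∣_)
open import Data.Product using (_×_)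

G : ℕ → ℤ → ℤ
G zero x = 1ℤ
G (suc zero) x = x
G (suc (suc i)) x = x * G (suc i) x - G i x

InA : ℤ → ℤ → Set
InA n a = (n > 1ℤ) × (1ℤ ≤ a) × (a < n) × (n ∣ (a * a - 1ℤ)) × (a ∣ (n * n - 1ℤ))

{-# OPTIONS --safe #-}
module Submission where

open import Defs
open import Data.Nat using (ℕ; zero; suc; z≤n)
open import Data.Integer using (ℤ; +_; 0ℤ; 1ℤ; _+_; _*_; _-_; -_; _≤_; _<_; +≤+; nonNegative)
open import Data.Integer.Properties
  using ( ≤-refl; ≤-trans; <⇒≤; ≤-<-trans; suc[i]≤j⇒i<j
        ; +-monoʳ-<; +-monoˡ-≤; neg-mono-<; *-monoʳ-≤-nonNeg; module ≤-Reasoning)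
open import Data.Integer.Divisibility using (_∣_)
open import Data.Integer.Divisibility.Signed using (divides; ∣⇒∣ᵤ)
open import Data.Integer.Solver using (module +-*-Solver)
open import Data.Product using (_×_; _,_)
open import Relation.Binary.PropositionalEquality using (_≡_; refl; sym; trans; cong; module ≡-Reasoning)

-- The recurrence (a, b) ↦ (b, k b − a) preserves the quadratic form
-- a² − k a b + b², which equals 1 at (G₀, G₁). Hence for consecutive
-- terms a = G_i(k), b = G_{i+1}(k) one gets a² − 1 = b (k a − b) and
-- b² − 1 = a (k b − a). For k ≥ 2 the sequence is positive and strictly
-- increasing, since k b − a ≥ 2b − a > b whenever 0 ≤ a < b.

open +-*-Solver

Q : ℤ → ℤ → ℤ → ℤ
Q k a b = a * a - k * a * b + b * b

Q̂ : ∀ {n} → Polynomial n → Polynomial n → Polynomial n → Polynomial n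
Q̂ k a b = a :* a :- k :* a :* b :+ b :* b

Q-sym : ∀ k a b → Q k a b ≡ Q k b a
Q-sym = solve 3 (λ k a b → Q̂ k a b := Q̂ k b a) refl

Q-step : ∀ k a b → Q k b (k * b - a) ≡ Q k a b
Q-step = solve 3 (λ k a b → Q̂ k b (k :* b :- a) := Q̂ k a b) refl

Q-G : ∀ k i → Q k (G i k) (G (suc i) k) ≡ 1ℤ
Q-G k zero    = solve 1 (λ k → Q̂ k (con 1ℤ) k := con 1ℤ) refl k
Q-G k (suc i) = trans (Q-step k (G i k) (G (suc i) k)) (Q-G k i)

Q≡1⇒a∣b*b-1 : ∀ k a b → Q k a b ≡ 1ℤ → a ∣ b * b - 1ℤ
Q≡1⇒a∣b*b-1 k a b Q≡1 = ∣⇒∣ᵤ (divides (k * b - a) (begin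
  b * b - 1ℤ      ≡⟨ cong (λ q → b * b - q) (sym Q≡1) ⟩
  b * b - Q k a b ≡⟨ b*b-Q≡[k*b-a]*a k a b ⟩
  (k * b - a) * a ∎))
  where
  open ≡-Reasoning
  b*b-Q≡[k*b-a]*a : ∀ k a b → b * b - Q k a b ≡ (k * b - a) * a
  b*b-Q≡[k*b-a]*a = solve 3 (λ k a b → b :* b :- Q̂ k a b := (k :* b :- a) :* a) refl

a<b⇒b<k*b-a : ∀ {k a b} → + 2 ≤ k → 0ℤ ≤ b → a < b → b < k * b - a
a<b⇒b<k*b-a {k} {a} {b} 2≤k 0≤b a<b = begin-strict
  b           ≡⟨ b≡2*b-b b ⟩
  + 2 * b - b <⟨ +-monoʳ-< (+ 2 * b) (neg-mono-< a<b) ⟩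
  + 2 * b - a ≤⟨ +-monoˡ-≤ (- a) (*-monoʳ-≤-nonNeg b ⦃ nonNegative 0≤b ⦄ 2≤k) ⟩
  k * b - a   ∎
  where
  open ≤-Reasoning
  b≡2*b-b : ∀ b → b ≡ + 2 * b - b
  b≡2*b-b = solve 1 (λ b → b := con (+ 2) :* b :- b) refl

G-positive-increasing : ∀ {k} → + 2 ≤ k → ∀ i → 1ℤ ≤ G i k × G i k < G (suc i) k
G-positive-increasing 2≤k zero = ≤-refl , suc[i]≤j⇒i<j 2≤k
G-positive-increasing {k} 2≤k (suc i) with G-positive-increasing 2≤k i
... | 1≤a , a<b = 1≤b , a<b⇒b<k*b-a 2≤k (≤-trans (+≤+ z≤n) 1≤b) a<b
  where
  1≤b : 1ℤ ≤ G (suc i) k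
  1≤b = ≤-trans 1≤a (<⇒≤ a<b)

lemma2p1 : (i : ℕ) → (k : ℤ) → + 2 ≤ k → InA (G (suc i) k) (G i k)
lemma2p1 i k 2≤k with G-positive-increasing 2≤k i
... | 1≤a , a<b =
  ≤-<-trans 1≤a a<b , 1≤a , a<b ,
  Q≡1⇒a∣b*b-1 k b a (trans (Q-sym k b a) (Q-G k i)) ,
  Q≡1⇒a∣b*b-1 k a b (Q-G k i)
  where
  a b : ℤ
  a = G i k
  b = G (suc i) k
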